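{- Let $\approx$ be an SCER on $\Sigma^*$ and $T$ a string of length $n$. For any $1\le j\le i\le n$, $T[:j]\in\mathsf{Cov}_{\approx}(T[:i])$ if and only if $j=\mathit{LCover}^q_T[i]$ for some $q\ge 0$.
   Context: $\Sigma^*$ is the set of strings over an alphabet $\Sigma$. For a string $T$, $|T|$ is its length, $T[i:j]$ the substring from position $i$ to $j$, $T[:j]=T[1:j]$, $T[i:]=T[i:|T|]$. An SCER is an equivalence relation $\approx$ on $\Sigma^*$ such that $X\approx Y$ implies $|X|=|Y|$ and $X[i:j]\approx Y[i:j]$ for all $1\le i\le j\le|X|$. $\mathsf{Occ}_{P,T}=\{\,i : 1\le i\le |T|-|P|+1,\ P\approx T[i:i+|P|-1]\,\}$. A string $C$ of length $c$ is a $\approx$-cover of $T$ of length $n$ if there are $x_1,\dots,x_m\in\mathsf{Occ}_{C,T}$ with $x_1=1$, $x_m=n-c+1$ and $x_{i-1}<x_i\le x_{i-1}+c$ for all $1<i\le m$; proper if $c<n$; $\mathsf{Cov}_\approx(T)$ is the set of all $\approx$-covers of $T$. $\mathit{LCover}_T[i]=\max(\{\,|C| : C \text{ is a proper }\approx\text{ -cover of } T[:i]\,\}\cup\{0\})$ for $1\le i\le n$. Iterates: $\mathit{LCover}^0_T[i]=i$ and $\mathit{LCover}^q_T[i]=\mathit{LCover}_T[\mathit{LCover}^{q-1}_T[i]]$ for $q\ge1$ (once the value $0$ is reached, further iterates are taken to be $0$). -}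

module Defs where

open import Level using (Level; _⊔_) renaming (suc to lsuc)
open import Data.Nat using (ℕ; zero; suc; _+_; _∸_; _≤_; _<_)
open import Data.List using (List; length; take; drop)
open import Data.List.NonEmpty using (List⁺; head; last; toList)
open import Data.List.Relation.Unary.All using (All)
open import Data.List.Relation.Unary.Linked using (Linked)
open import Data.Product using (Σ; ∃; _×_)
open import Data.Sum using (_⊎_)
open import Relation.Binary.Core using (Rel)
open import Relation.Binary.Structures using (IsEquivalence)
open import Relation.Binary.PropositionalEquality using (_≡_)

-- Strings over Σ are lists; positions are 1-based as in the paper.

prefix : ∀ {a} {A : Set a} → ℕ → List A → List A
prefix j T = take j T

-- substring T[i:j] (meaningful for 1 ≤ i ≤ j ≤ |T|)
sub : ∀ {a} {A : Set a} → List A → ℕ → ℕ → List A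
sub T i j = take (suc j ∸ i) (drop (i ∸ 1) T)

record SCER {a} (A : Set a) (ℓ : Level) : Set (a ⊔ lsuc ℓ) where
  field
    _≈_     : Rel (List A) ℓ
    isEquiv : IsEquivalence _≈_
    ≈-len   : ∀ {X Y} → X ≈ Y → length X ≡ length Y
    ≈-sub   : ∀ {X Y} → X ≈ Y → ∀ i j → 1 ≤ i → i ≤ j → j ≤ length X →
              sub X i j ≈ sub Y i j

module _ {a ℓ} {A : Set a} (S : SCER A ℓ) where
  open SCER S

  Occ : List A → List A → ℕ → Set ℓ
  Occ P T i = (1 ≤ i) × (i ≤ length T ∸ length P + 1) × (P ≈ sub T i (i + length P ∸ 1))

  IsCover : List A → List A → Set ℓ
  IsCover C T = Σ (List⁺ ℕ) λ xs →
      (head xs ≡ 1)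
    × (last xs ≡ length T ∸ length C + 1)
    × All (Occ C T) (toList xs)
    × Linked (λ x y → (x < y) × (y ≤ x + length C)) (toList xs)

  IsProperCover : List A → List A → Set ℓ
  IsProperCover C T = IsCover C T × (length C < length T)

  IsLCover : List A → ℕ → ℕ → Set (a ⊔ ℓ)
  IsLCover T i v =
      ((v ≡ 0) ⊎ (Σ (List A) λ C → IsProperCover C (prefix i T) × (length C ≡ v)))
    × (∀ C → IsProperCover C (prefix i T) → length C ≤ v)

-- iterates of a function L : ℕ → ℕ with the convention that 0 stays 0
L₀ : (ℕ → ℕ) → ℕ → ℕ
L₀ L zero    = zero
L₀ L (suc k) = L (suc k)

iter : (ℕ → ℕ) → ℕ → ℕ → ℕ
iter L zero    i = i
iter L (suc q) i = L₀ L (iter L q i)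

-- Read a cover position-wise: T[:j] covers T[:i] iff every position of T[:i] lies in
-- the window of an occurrence of T[:j] inside T[:i]. In this form covers compose, and
-- if T[:j] and T[:l] both cover T[:i] with j ≤ l, then T[:j] covers T[:l]: a window
-- sticking out of T[:l] can be traded for the occurrence of T[:j] as a suffix of T[:l],
-- which exists because T[:j] and T[:l] are both suffixes of T[:i]. Hence the covers of
-- T[:i] shorter than i are exactly the covers of T[:LCover_T[i]], and strong induction
-- on i gives the chain.
module Submission where

open import Defs
open import Data.Nat using (ℕ; zero; suc; _+_; _∸_; _⊓_; _≤_; _<_; z≤n; s≤s; _≤?_; _<?_; _≟_)
open import Data.Nat.Properties
open import Data.Nat.Induction using (<-wellFounded)
open import Data.List using (List; []; _∷_; length; take; drop; initLast; _∷ʳ′_)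
open import Data.List.Properties using (length-take; take-drop; take-take; drop-drop)
open import Data.List.NonEmpty using (_∷_; head; last; toList)
open import Data.List.Relation.Unary.All using (All; []; _∷_)
open import Data.List.Relation.Unary.Linked using (Linked; [-]; _∷_)
open import Data.Product using (∃; _×_; _,_; proj₁; proj₂)
open import Data.Sum using (inj₁; inj₂)
open import Function.Bundles using (_⇔_; mk⇔; Equivalence)
open import Function.Construct.Composition using (_⇔-∘_)
open import Induction.WellFounded using (Acc; acc)
open import Relation.Nullary using (yes; no; contradiction)
open import Relation.Binary.PropositionalEquality
  using (_≡_; refl; sym; trans; cong; subst; subst₂; module ≡-Reasoning)
open import Relation.Binary.Structures using (IsEquivalence)

last-∷ : ∀ {a} {A : Set a} (x y : A) ys → last (x ∷ y ∷ ys) ≡ last (y ∷ ys)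
last-∷ x y ys with initLast ys
... | []       = refl
... | zs ∷ʳ′ z = refl

take-drop-take : ∀ {a} {A : Set a} {x j k} (U : List A) → x + j ≤ k →
                 take j (drop x (take k U)) ≡ take j (drop x U)
take-drop-take {x = x} {j} {k} U x+j≤k = begin
  take j (drop x (take k U))        ≡⟨ take-drop j x (take k U) ⟩
  drop x (take (x + j) (take k U))  ≡⟨ cong (drop x) (take-take (x + j) k U) ⟩
  drop x (take ((x + j) ⊓ k) U)     ≡⟨ cong (λ m → drop x (take m U)) (m≤n⇒m⊓n≡m x+j≤k) ⟩
  drop x (take (x + j) U)           ≡⟨ take-drop j x U ⟨
  take j (drop x U)                 ∎
  where open ≡-Reasoning

sub≡take-drop : ∀ {a} {A : Set a} (U : List A) x j → sub U (suc x) (x + j) ≡ take j (drop x U)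
sub≡take-drop U x j = cong (λ m → take m (drop x U)) (m+n∸m≡n x j)

Gapless : ℕ → ℕ → ℕ → Set
Gapless c x y = x < y × y ≤ x + c

module _ {p} {P : ℕ → Set p} (c : ℕ) where

  linked-window : ∀ {xs q} → All P (toList xs) → Linked (Gapless c) (toList xs) →
                  head xs ≤ q → q < last xs + c → ∃ λ w → P w × w ≤ q × q < w + c
  linked-window {_ ∷ []} (px ∷ []) [-] x≤q q<end = _ , px , x≤q , q<end
  linked-window {x ∷ y ∷ ys} {q} (px ∷ ps) ((_ , y≤x+c) ∷ link) x≤q q<end with q <? x + c
  ... | yes q<x+c = x , px , x≤q , q<x+c
  ... | no  q≮x+c = linked-window {y ∷ ys} ps link (≤-trans y≤x+c (≮⇒≥ q≮x+c))
                      (subst (λ l → q < l + c) (last-∷ x y ys) q<end)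

  linked-from : ∀ {e} → (∀ {x} → P x → x ≤ e) →
                (∀ {x} → P x → x < e → ∃ λ y → P y × Gapless c x y) →
                ∀ {x} → P x →
                ∃ λ xs → head xs ≡ x × last xs ≡ e × All P (toList xs) × Linked (Gapless c) (toList xs)
  linked-from {e} bound extend = go (<-wellFounded _)
    where
    go : ∀ {x} → Acc _<_ (e ∸ x) → P x →
         ∃ λ xs → head xs ≡ x × last xs ≡ e × All P (toList xs) × Linked (Gapless c) (toList xs)
    go {x} (acc rs) px with x <? e
    ... | no x≮e = x ∷ [] , refl , ≤-antisym (bound px) (≮⇒≥ x≮e) , px ∷ [] , [-]
    ... | yes x<e with extend px x<e
    ... | y , py , gap with go (rs (∸-monoʳ-< (proj₁ gap) (bound py))) py
    ... | _ ∷ ys , refl , end , ps , link =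
      x ∷ y ∷ ys , refl , trans (last-∷ x y ys) end , px ∷ ps , gap ∷ link

iter-L₀-comm : ∀ L q i → iter L q (L₀ L i) ≡ L₀ L (iter L q i)
iter-L₀-comm L zero    i = refl
iter-L₀-comm L (suc q) i = cong (L₀ L) (iter-L₀-comm L q i)

iter-suc : ∀ L q {i} → 1 ≤ i → iter L (suc q) i ≡ iter L q (L i)
iter-suc L q {suc k} _ = sym (iter-L₀-comm L q (suc k))

module SCERProperties {a ℓ} {A : Set a} (S : SCER A ℓ) where
  open SCER S
  open IsEquivalence isEquiv using () renaming (refl to ≈-refl)

  ≈-take-drop : ∀ {U V} x j → U ≈ V → x + j ≤ length U → take j (drop x U) ≈ take j (drop x V)
  ≈-take-drop x zero    _   _    = ≈-refl
  ≈-take-drop {U} {V} x (suc j) U≈V fits =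
    subst₂ _≈_ (sub≡take-drop U x (suc j)) (sub≡take-drop V x (suc j))
      (≈-sub U≈V (suc x) (x + suc j) (s≤s z≤n) (m<m+n x (s≤s z≤n)) fits)

module PrefixCovers {a ℓ} {A : Set a} (S : SCER A ℓ) (T : List A) where
  open SCER S
  open IsEquivalence isEquiv renaming (refl to ≈-refl; sym to ≈-sym; trans to ≈-trans)
  open SCERProperties S

  n : ℕ
  n = length T

  length-prefix : ∀ {i} → i ≤ n → length (take i T) ≡ i
  length-prefix {i} i≤n = trans (length-take i T) (m≤n⇒m⊓n≡m i≤n)

  -- Offsets x and positions p are 0-based (unlike Occ): T[:j] occurs at x when it
  -- equals T[x+1 : x+j].
  factor : ℕ → ℕ → List A
  factor x j = take j (drop x T)

  Occurs : ℕ → ℕ → Set ℓ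
  Occurs j x = factor 0 j ≈ factor x j

  occurs-factor : ∀ {k y x j} → Occurs k y → x + j ≤ k → k ≤ n → factor x j ≈ factor (y + x) j
  occurs-factor {k} {y} {x} {j} occ fits k≤n =
    subst₂ _≈_ (take-drop-take T fits)
               (trans (take-drop-take (drop y T) fits) (cong (take j) (drop-drop y x T)))
               (≈-take-drop x j occ (subst (x + j ≤_) (sym (length-prefix k≤n)) fits))

  record CoveringOccurrence (j i p : ℕ) : Set ℓ where
    constructor window
    field
      start   : ℕ
      fits    : start + j ≤ i
      occurs  : Occurs j start
      start≤p : start ≤ p
      p<end   : p < start + j

  Covers : ℕ → ℕ → Set ℓ
  Covers j i = ∀ {p} → p < i → CoveringOccurrence j i p

  covers-refl : ∀ {i} → Covers i i
  covers-refl p<i = window 0 ≤-refl ≈-refl z≤n p<i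

  covers-trans : ∀ {j k i} → k ≤ n → Covers j k → Covers k i → Covers j i
  covers-trans {j} {k} {i} k≤n cov-jk cov-ki p<i with cov-ki p<i
  ... | window y y+k≤i occ-y y≤p p<y+k with m≤n⇒∃[o]m+o≡n y≤p
  ... | d , refl with cov-jk (+-cancelˡ-< y d k p<y+k)
  ... | window x x+j≤k occ-x x≤d d<x+j =
    window (y + x) fits (≈-trans occ-x (occurs-factor {y = y} occ-y x+j≤k k≤n))
           (+-monoʳ-≤ y x≤d) (subst (y + d <_) (sym (+-assoc y x j)) (+-monoʳ-< y d<x+j))
    where
    fits : y + x + j ≤ i
    fits = subst (_≤ i) (sym (+-assoc y x j)) (≤-trans (+-monoʳ-≤ y x+j≤k) y+k≤i)

  covers-suffix : ∀ {j i} → j ≤ i → Covers j i → ∃ λ x → x + j ≡ i × Occurs j x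
  covers-suffix {i = zero}  z≤n _   = 0 , refl , ≈-refl
  covers-suffix {i = suc i} _   cov with cov ≤-refl
  ... | window x x+j≤1+i occ _ 1+i≤x+j = x , ≤-antisym x+j≤1+i 1+i≤x+j , occ

  covers-between : ∀ {j l i} → j ≤ l → l ≤ i → i ≤ n → Covers j i → Covers l i → Covers j l
  covers-between {j} {l} {i} j≤l l≤i i≤n cov-j cov-l {p} p<l
    with covers-suffix (≤-trans j≤l l≤i) cov-j | covers-suffix l≤i cov-l
  ... | x , x+j≡i , occ-x | y , y+l≡i , occ-y with cov-j {p} (<-≤-trans p<l l≤i)
  ... | window x′ x′+j≤i occ′ x′≤p p<x′+j with x′ + j ≤? l
  ... | yes x′+j≤l = window x′ x′+j≤l occ′ x′≤p p<x′+j
  ... | no  x′+j≰l = window z (≤-reflexive z+j≡l) occ-z (<⇒≤ (<-≤-trans z<x′ x′≤p))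
                       (subst (p <_) (sym z+j≡l) p<l)
    where
    z : ℕ
    z = l ∸ j
    z+j≡l : z + j ≡ l
    z+j≡l = m∸n+n≡m j≤l
    z<x′ : z < x′
    z<x′ = +-cancelʳ-< j z x′ (subst (_< x′ + j) (sym z+j≡l) (≰⇒> x′+j≰l))
    y+z≡x : y + z ≡ x
    y+z≡x = +-cancelʳ-≡ j (y + z) x
      (trans (+-assoc y z j) (trans (cong (y +_) z+j≡l) (trans y+l≡i (sym x+j≡i))))
    occ-z : Occurs j z
    occ-z = ≈-trans occ-x (≈-sym (subst (λ m → factor z j ≈ factor m j) y+z≡x
              (occurs-factor {y = y} occ-y (≤-reflexive z+j≡l) (≤-trans l≤i i≤n))))

  Occ-bound⇒fits : ∀ {x c i} → c ≤ i → i ≤ n → suc x ≤ length (take i T) ∸ c + 1 → x + c ≤ i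
  Occ-bound⇒fits {x} {c} {i} c≤i i≤n bound rewrite length-prefix i≤n | +-comm (i ∸ c) 1 =
    m≤o∸n⇒m+n≤o x c≤i (≤-pred bound)

  fits⇒Occ-bound : ∀ {x c i} → i ≤ n → x + c ≤ i → suc x ≤ length (take i T) ∸ c + 1
  fits⇒Occ-bound {x} {c} {i} i≤n fits rewrite length-prefix i≤n | +-comm (i ∸ c) 1 =
    s≤s (m+n≤o⇒m≤o∸n x fits)

  Occ-prefix⁻ : ∀ {C i w} → length C ≤ i → i ≤ n → Occ S C (take i T) w →
                ∃ λ x → w ≡ suc x × x + length C ≤ i × C ≈ factor x (length C)
  Occ-prefix⁻ {w = zero} _ _ (() , _)
  Occ-prefix⁻ {C} {i} {suc x} c≤i i≤n (_ , bound , C≈) =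
    x , refl , fits ,
    subst (C ≈_) (trans (sub≡take-drop (take i T) x (length C)) (take-drop-take T fits)) C≈
    where
    fits : x + length C ≤ i
    fits = Occ-bound⇒fits c≤i i≤n bound

  Occ-prefix⁺ : ∀ {C i x} → i ≤ n → x + length C ≤ i → C ≈ factor x (length C) →
                Occ S C (take i T) (suc x)
  Occ-prefix⁺ {C} {i} {x} i≤n fits C≈ =
    s≤s z≤n , fits⇒Occ-bound i≤n fits ,
    subst (C ≈_) (sym (trans (sub≡take-drop (take i T) x (length C)) (take-drop-take T fits))) C≈

  last-window-end : ∀ {c i} → c ≤ i → i ≤ n → length (take i T) ∸ c + 1 + c ≡ suc i
  last-window-end {c} {i} c≤i i≤n rewrite length-prefix i≤n | +-comm (i ∸ c) 1 =
    cong suc (m∸n+n≡m c≤i)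

  IsCover⇒Covers : ∀ {C i} → length C ≤ i → i ≤ n → IsCover S C (take i T) → Covers (length C) i
  IsCover⇒Covers {C} {i} c≤i i≤n (_ ∷ _ , refl , last≡ , occs@(occ₁ ∷ _) , link) {p} p<i
    with linked-window (length C) occs link (s≤s z≤n)
           (subst (λ l → suc p < l + length C) (sym last≡)
             (subst (suc p <_) (sym (last-window-end c≤i i≤n)) (s≤s p<i)))
  ... | _ , occ , w≤1+p , 1+p<w+c with Occ-prefix⁻ c≤i i≤n occ | Occ-prefix⁻ c≤i i≤n occ₁
  ... | x , refl , x+c≤i , C≈x | _ , refl , _ , C≈0 =
    window x x+c≤i (≈-trans (≈-sym C≈0) C≈x) (≤-pred w≤1+p) (≤-pred 1+p<w+c)

  Covers⇒IsCover : ∀ {C i} → C ≈ take (length C) T → length C ≤ i → i ≤ n →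
                   Covers (length C) i → IsCover S C (take i T)
  Covers⇒IsCover {C} {i} C≈ c≤i i≤n cov =
    linked-from (length C) (λ occ → proj₁ (proj₂ occ)) extend (Occ-prefix⁺ i≤n c≤i C≈)
    where
    extend : ∀ {w} → Occ S C (take i T) w → w < length (take i T) ∸ length C + 1 →
             ∃ λ v → Occ S C (take i T) v × Gapless (length C) w v
    extend occ w<end with Occ-prefix⁻ c≤i i≤n occ
    ... | x , refl , _ , _ with cov (Occ-bound⇒fits c≤i i≤n w<end)
    ... | window y y+c≤i occ-y y≤x+c x+c<y+c =
      suc y , Occ-prefix⁺ i≤n y+c≤i (≈-trans C≈ occ-y) ,
      s≤s (+-cancelʳ-< (length C) x y x+c<y+c) , s≤s y≤x+c

  prefix-IsCover⇔Covers : ∀ {j i} → j ≤ i → i ≤ n → IsCover S (take j T) (take i T) ⇔ Covers j i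
  prefix-IsCover⇔Covers {j} {i} j≤i i≤n = mk⇔ to from
    where
    len-j : length (take j T) ≡ j
    len-j = length-prefix (≤-trans j≤i i≤n)
    len-j≤i : length (take j T) ≤ i
    len-j≤i = subst (_≤ i) (sym len-j) j≤i
    prefix≈ : take j T ≈ take (length (take j T)) T
    prefix≈ = subst (λ c → take j T ≈ take c T) (sym len-j) ≈-refl
    to : IsCover S (take j T) (take i T) → Covers j i
    to cov = subst (λ c → Covers c i) len-j (IsCover⇒Covers len-j≤i i≤n cov)
    from : Covers j i → IsCover S (take j T) (take i T)
    from cov = Covers⇒IsCover prefix≈ len-j≤i i≤n (subst (λ c → Covers c i) (sym len-j) cov)

  module Iterates (L : ℕ → ℕ) (isLCover : ∀ i → 1 ≤ i → i ≤ n → IsLCover S T i (L i)) where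

    lcover-covers : ∀ {m} → 1 ≤ m → m ≤ n → 1 ≤ L m → L m < m × Covers (L m) m
    lcover-covers {m} 1≤m m≤n 1≤Lm with proj₁ (isLCover m 1≤m m≤n)
    ... | inj₁ Lm≡0 = contradiction (subst (1 ≤_) Lm≡0 1≤Lm) λ ()
    ... | inj₂ (C , (cov , shorter) , len-C) =
      subst (λ c → c < m × Covers c m) len-C (len-C<m , IsCover⇒Covers (<⇒≤ len-C<m) m≤n cov)
      where
      len-C<m : length C < m
      len-C<m = subst (length C <_) (length-prefix m≤n) shorter

    lcover-maximal : ∀ {j i} → j < i → i ≤ n → Covers j i → j ≤ L i
    lcover-maximal {j} {i} j<i i≤n cov =
      subst (_≤ L i) len-j (proj₂ (isLCover i (≤-trans (s≤s z≤n) j<i) i≤n) (take j T)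
        (Equivalence.from (prefix-IsCover⇔Covers (<⇒≤ j<i) i≤n) cov ,
         subst₂ _<_ (sym len-j) (sym (length-prefix i≤n)) j<i))
      where
      len-j : length (take j T) ≡ j
      len-j = length-prefix (≤-trans (<⇒≤ j<i) i≤n)

    iterate-covers : ∀ {i} q → i ≤ n → 1 ≤ iter L q i → iter L q i ≤ i × Covers (iter L q i) i
    iterate-covers zero _ _ = ≤-refl , covers-refl
    iterate-covers {i} (suc q) i≤n pos with iter L q i | iterate-covers {i} q i≤n
    ... | zero  | _  = contradiction pos λ ()
    ... | suc m | ih with ih (s≤s z≤n)
    ... | m≤i , cov-m with lcover-covers (s≤s z≤n) (≤-trans m≤i i≤n) pos
    ... | Lm<m , cov-Lm = ≤-trans (<⇒≤ Lm<m) m≤i , covers-trans (≤-trans m≤i i≤n) cov-Lm cov-m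

    covers⇒iterate : ∀ {j i} → 1 ≤ j → Acc _<_ i → j ≤ i → i ≤ n → Covers j i →
                     ∃ λ q → j ≡ iter L q i
    covers⇒iterate {j} {i} 1≤j (acc rs) j≤i i≤n cov with j ≟ i
    ... | yes refl = 0 , refl
    ... | no j≢i with lcover-maximal (≤∧≢⇒< j≤i j≢i) i≤n cov
    ... | j≤Li with lcover-covers (≤-trans 1≤j j≤i) i≤n (≤-trans 1≤j j≤Li)
    ... | Li<i , cov-Li with covers⇒iterate 1≤j (rs Li<i) j≤Li (≤-trans (<⇒≤ Li<i) i≤n)
                               (covers-between j≤Li (<⇒≤ Li<i) i≤n cov cov-Li)
    ... | q , j≡ = suc q , trans j≡ (sym (iter-suc L q (≤-trans 1≤j j≤i)))

    Covers⇔iterate : ∀ {j i} → 1 ≤ j → j ≤ i → i ≤ n → Covers j i ⇔ (∃ λ q → j ≡ iter L q i)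
    Covers⇔iterate {j} {i} 1≤j j≤i i≤n = mk⇔
      (covers⇒iterate 1≤j (<-wellFounded i) j≤i i≤n)
      (λ (q , j≡) → subst (λ m → Covers m i) (sym j≡)
                      (proj₂ (iterate-covers q i≤n (subst (1 ≤_) j≡ 1≤j))))

lemma9 : ∀ {a ℓ} {A : Set a} (S : SCER A ℓ) (T : List A)
    → (L : ℕ → ℕ)
    → (∀ i → 1 ≤ i → i ≤ length T → IsLCover S T i (L i))
    → ∀ i j → 1 ≤ j → j ≤ i → i ≤ length T
    → IsCover S (prefix j T) (prefix i T) ⇔ (∃ λ q → j ≡ iter L q i)
lemma9 S T L isLCover i j 1≤j j≤i i≤n =
  Covers⇔iterate 1≤j j≤i i≤n ⇔-∘ prefix-IsCover⇔Covers j≤i i≤n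
  where
  open PrefixCovers S T
  open Iterates L isLCover
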